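{- Let $\mathcal{V}$ be a variety of connected po-groupoids. Then there exist a positive integer $n$ and binary terms $m_1(x,y),\dots,m_{2n-1}(x,y)$ in the language of $\mathcal{V}$ such that $\mathcal{V}$ satisfies $m_1(x,y)\cdot x\approx m_1(x,y)$, $m_{2n-1}(x,y)\cdot y\approx m_{2n-1}(x,y)$, and, for every odd $i$ with $1\le i\le 2n-3$, $m_i(x,y)\cdot m_{i+1}(x,y)\approx m_i(x,y)$ and $m_{i+2}(x,y)\cdot m_{i+1}(x,y)\approx m_{i+2}(x,y)$ (i.e. $x\succeq m_1\preceq m_2\succeq\dots\preceq m_{2n-2}\succeq m_{2n-1}\preceq y$ holds identically).
   Context: A po-groupoid is a groupoid $\langle A,\cdot\rangle$ such that $x\preceq y :\iff x\cdot y=x$ is a partial order on $A$. A variety of po-groupoids is a variety with a binary term $\cdot$ such that every member is a po-groupoid under $\cdot$. It is a variety of connected po-groupoids if the order of every member is connected, i.e. any two elements $x,y$ are joined by a zigzag $x\succeq m_1\preceq m_2\succeq\dots\preceq m_{2n-2}\succeq m_{2n-1}\preceq y$. -}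

module Defs where

open import Data.Nat using (ℕ; zero; suc; _+_; _*_; _<_)
open import Data.Fin using (Fin; zero; suc)
open import Data.Product using (Σ; _×_; _,_; ∃)
open import Relation.Binary using (Setoid; Rel)
open import Level using (0ℓ)
open import Relation.Binary.PropositionalEquality using (_≡_)

record Signature : Set₁ where
  field
    Op    : Set
    arity : Op → ℕ
open Signature public

data Term (S : Signature) (X : Set) : Set where
  var : X → Term S X
  op  : (f : Op S) → (Fin (arity S f) → Term S X) → Term S X

Identity : Signature → Set
Identity S = Term S ℕ × Term S ℕ

record Algebra (S : Signature) : Set₁ where
  field
    setoid : Setoid 0ℓ 0ℓ
  open Setoid setoid public
  field
    interp : (f : Op S) → (Fin (arity S f) → Carrier) → Carrier
    interp-cong : (f : Op S) {as bs : Fin (arity S f) → Carrier} →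
                  (∀ i → as i ≈ bs i) → interp f as ≈ interp f bs

module _ {S : Signature} (A : Algebra S) where
  open Algebra A

  eval : {X : Set} → (X → Carrier) → Term S X → Carrier
  eval ρ (var x)  = ρ x
  eval ρ (op f ts) = interp f (λ i → eval ρ (ts i))

  Satisfies : Identity S → Set
  Satisfies (s , t) = (ρ : ℕ → Carrier) → eval ρ s ≈ eval ρ t

  env₂ : Carrier → Carrier → Fin 2 → Carrier
  env₂ a b zero = a
  env₂ a b (suc _) = b

  eval₂ : Term S (Fin 2) → Carrier → Carrier → Carrier
  eval₂ t a b = eval (env₂ a b) t

  _≼[_]_ : Carrier → Term S (Fin 2) → Carrier → Set
  a ≼[ t ] b = eval₂ t a b ≈ a

-- The variety defined by a set E of identities: its members are the models of E.
-- (Birkhoff: every variety is of this form.)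
_∈Mod_ : {S : Signature} → Algebra S → (Identity S → Set) → Set
A ∈Mod E = ∀ e → E e → Satisfies A e

-- A zigzag of length 2n-1 (n = suc k) between x and y for a relation _≤_
-- (where a ≤ b reads a ⪯ b), given by the sequence m 1, …, m (2n-1):
--   x ⪰ m 1 ⪯ m 2 ⪰ … ⪯ m (2n-2) ⪰ m (2n-1) ⪯ y,
-- i.e. m 1 ⪯ x, m (2n-1) ⪯ y, and for every odd i = 2j+1 with 1 ≤ i ≤ 2n-3
-- (i.e. j < k): m i ⪯ m (i+1) and m (i+2) ⪯ m (i+1).
ZigZag : {A : Set} → (A → A → Set) → A → A → (k : ℕ) → (ℕ → A) → Set
ZigZag _≤_ x y k m =
  (m 1 ≤ x) × (m (2 * k + 1) ≤ y) ×
  (∀ j → j < k → (m (2 * j + 1) ≤ m (2 * j + 2)) × (m (2 * j + 3) ≤ m (2 * j + 2)))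

module _ {S : Signature} (A : Algebra S) (t : Term S (Fin 2)) where
  open Algebra A

  private
    _≼_ : Carrier → Carrier → Set
    u ≼ v = _≼[_]_ A u t v

  record IsPoGroupoid : Set where
    field
      refl≼  : ∀ a → a ≼ a
      antisym≼ : ∀ a b → a ≼ b → b ≼ a → a ≈ b
      trans≼ : ∀ a b c → a ≼ b → b ≼ c → a ≼ c

  IsConnected : Set
  IsConnected = ∀ a b → Σ ℕ λ k → Σ (ℕ → Carrier) λ m → ZigZag _≼_ a b k m

-- Apply connectedness in the free algebra of the variety on two generators x, y:
-- the zigzag it yields between x and y consists of binary terms, and each of its
-- links t(p, q) = p is an equation derivable from the defining identities.  Such
-- an equation holds in every member of the variety under every assignment, so
-- evaluating the terms at (a, b) gives a zigzag between a and b.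
module Submission where

open import Defs
open import Data.Nat using (ℕ)
open import Data.Fin using (Fin; zero; suc)
open import Data.Product using (Σ; _,_; proj₁; proj₂)
open import Function using (_∘_)

ZigZag-map : {A B : Set} (_≤_ : A → A → Set) (_≤′_ : B → B → Set) (f : A → B) →
             (∀ {u v} → u ≤ v → f u ≤′ f v) →
             ∀ x y k m → ZigZag _≤_ x y k m → ZigZag _≤′_ (f x) (f y) k (f ∘ m)
ZigZag-map _ _ f mono _ _ _ _ (m₁≤x , m≤y , links) =
  mono m₁≤x , mono m≤y , λ j j<k → mono (proj₁ (links j j<k)) , mono (proj₂ (links j j<k))

module _ {S : Signature} where

  infixl 8 _[_]
  infix 4 _⊢_≈_

  _[_] : {X Y : Set} → Term S X → (X → Term S Y) → Term S Y
  var x   [ σ ] = σ x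
  op f ts [ σ ] = op f (λ i → ts i [ σ ])

  module _ (A : Algebra S) where
    open Algebra A

    eval-cong : {X : Set} {ρ ρ′ : X → Carrier} → (∀ x → ρ x ≈ ρ′ x) →
                (u : Term S X) → eval A ρ u ≈ eval A ρ′ u
    eval-cong ρ≈ρ′ (var x)   = ρ≈ρ′ x
    eval-cong ρ≈ρ′ (op f ts) = interp-cong f (λ i → eval-cong ρ≈ρ′ (ts i))

    eval-[] : {X Y : Set} (ρ : Y → Carrier) (σ : X → Term S Y) (u : Term S X) →
              eval A ρ (u [ σ ]) ≈ eval A (eval A ρ ∘ σ) u
    eval-[] ρ σ (var x)   = refl
    eval-[] ρ σ (op f ts) = interp-cong f (λ i → eval-[] ρ σ (ts i))

  data _⊢_≈_ (E : Identity S → Set) {X : Set} : Term S X → Term S X → Set where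
    refl  : ∀ {s} → E ⊢ s ≈ s
    sym   : ∀ {s u} → E ⊢ s ≈ u → E ⊢ u ≈ s
    trans : ∀ {s u v} → E ⊢ s ≈ u → E ⊢ u ≈ v → E ⊢ s ≈ v
    cong  : ∀ f {ss us : Fin (arity S f) → Term S X} →
            (∀ i → E ⊢ ss i ≈ us i) → E ⊢ op f ss ≈ op f us
    axiom : ∀ {s u} → E (s , u) → (σ : ℕ → Term S X) → E ⊢ s [ σ ] ≈ u [ σ ]

  module _ (E : Identity S → Set) where

    FreeAlgebra : Set → Algebra S
    FreeAlgebra X = record
      { setoid      = record
        { Carrier       = Term S X
        ; _≈_           = E ⊢_≈_
        ; isEquivalence = record { refl = refl ; sym = sym ; trans = trans }
        }
      ; interp      = op
      ; interp-cong = cong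
      }

    eval-free : {X Y : Set} (ρ : X → Term S Y) (u : Term S X) →
                E ⊢ eval (FreeAlgebra Y) ρ u ≈ u [ ρ ]
    eval-free ρ (var x)   = refl
    eval-free ρ (op f ts) = cong f (λ i → eval-free ρ (ts i))

    FreeAlgebra∈Mod : (X : Set) → FreeAlgebra X ∈Mod E
    FreeAlgebra∈Mod X (s , u) e ρ =
      trans (eval-free ρ s) (trans (axiom e ρ) (sym (eval-free ρ u)))

    module _ (A : Algebra S) (A∈E : A ∈Mod E) where
      open Algebra A using (_≈_) renaming (refl to ≈-refl; sym to ≈-sym; trans to ≈-trans)

      sound : {X : Set} {s u : Term S X} → E ⊢ s ≈ u →
              (ρ : X → Algebra.Carrier A) → eval A ρ s ≈ eval A ρ u
      sound refl          ρ = ≈-refl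
      sound (sym d)       ρ = ≈-sym (sound d ρ)
      sound (trans d d′)  ρ = ≈-trans (sound d ρ) (sound d′ ρ)
      sound (cong f ds)   ρ = Algebra.interp-cong A f (λ i → sound (ds i) ρ)
      sound (axiom {s} {u} e σ) ρ =
        ≈-trans (eval-[] A ρ σ s)
                (≈-trans (A∈E (s , u) e (eval A ρ ∘ σ)) (≈-sym (eval-[] A ρ σ u)))

      eval₂-free : (t p q : Term S (Fin 2)) (a b : Algebra.Carrier A) →
                   eval₂ A (eval₂ (FreeAlgebra (Fin 2)) t p q) a b
                     ≈ eval₂ A t (eval₂ A p a b) (eval₂ A q a b)
      eval₂-free t p q a b =
        ≈-trans (sound (eval-free (env₂ _ p q) t) (env₂ A a b))
                (≈-trans (eval-[] A (env₂ A a b) (env₂ _ p q) t)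
                         (eval-cong A env₂-eval t))
        where
          env₂-eval : ∀ x → eval A (env₂ A a b) (env₂ (FreeAlgebra (Fin 2)) p q x)
                              ≈ env₂ A (eval₂ A p a b) (eval₂ A q a b) x
          env₂-eval zero    = ≈-refl
          env₂-eval (suc _) = ≈-refl

      ≼-free⇒≼-eval₂ : (t : Term S (Fin 2)) {p q : Term S (Fin 2)} →
                       _≼[_]_ (FreeAlgebra (Fin 2)) p t q → (a b : Algebra.Carrier A) →
                       _≼[_]_ A (eval₂ A p a b) t (eval₂ A q a b)
      ≼-free⇒≼-eval₂ t {p} {q} p≼q a b =
        ≈-trans (≈-sym (eval₂-free t p q a b)) (sound p≼q (env₂ A a b))

      zigzag-free⇒zigzag-eval₂ :
        (t p q : Term S (Fin 2)) (k : ℕ) (m : ℕ → Term S (Fin 2)) →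
        ZigZag (λ u v → _≼[_]_ (FreeAlgebra (Fin 2)) u t v) p q k m →
        (a b : Algebra.Carrier A) →
        ZigZag (λ u v → _≼[_]_ A u t v) (eval₂ A p a b) (eval₂ A q a b) k (λ i → eval₂ A (m i) a b)
      zigzag-free⇒zigzag-eval₂ t p q k m zigzag a b =
        ZigZag-map (λ u v → _≼[_]_ (FreeAlgebra (Fin 2)) u t v) (λ u v → _≼[_]_ A u t v)
                   (λ r → eval₂ A r a b) (λ u≼v → ≼-free⇒≼-eval₂ t u≼v a b) p q k m zigzag

lemma2p3 : (S : Signature) (E : Identity S → Set) (t : Term S (Fin 2)) →
    (∀ (A : Algebra S) → A ∈Mod E → IsPoGroupoid A t) →
    (∀ (A : Algebra S) → A ∈Mod E → IsConnected A t) →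
    Σ ℕ λ k → Σ (ℕ → Term S (Fin 2)) λ m →
    ∀ (A : Algebra S) → A ∈Mod E →
    ∀ a b → ZigZag (λ u v → _≼[_]_ A u t v) a b k (λ i → eval₂ A (m i) a b)
lemma2p3 S E t _ connected
  with connected (FreeAlgebra E (Fin 2)) (FreeAlgebra∈Mod E (Fin 2)) (var zero) (var (suc zero))
... | k , m , zigzag =
  k , m , λ A A∈E a b →
    zigzag-free⇒zigzag-eval₂ E A A∈E t (var zero) (var (suc zero)) k m zigzag a b
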